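{- If $M$ is a non-trivial snake, then \[ T(M;2,0)\cdot T(M;0,2)\geq\frac{4}{3}\cdot T(M;1,1)^2. \]
   Context: $T(M;x,y)=\sum_{A\subseteq E}(x-1)^{r(E)-r(A)}(y-1)^{|A|-r(A)}$ is the Tutte polynomial of a matroid $M$ on $E$ with rank function $r$. Lattice path matroids: for lattice paths $P,Q$ (steps $N=(0,1)$, $E=(1,0)$) from $(0,0)$ to $(m,r)$ with $P$ never above $Q$, $M[P,Q]$ is the matroid on $\{1,\dots,m+r\}$ whose bases are the $r$-subsets $B$ such that the lattice path with North steps exactly at the positions in $B$ stays in the closed region (diagram) bounded by $P$ and $Q$. Snakes: an LPM $M[P,Q]$ is a snake if it has at least two elements, is connected (not a direct sum of two nonempty matroids), and its diagram has no lattice points in its interior. The trivial snake is the one whose diagram is a single unit square (the matroid $U_{1,2}$ of two parallel elements); a non-trivial snake is any other snake. -}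

module Defs where

open import Data.Nat as ℕ using (ℕ; zero; suc; _+_; _∸_; _≤_; _<_; _⊔_; _≤ᵇ_; _≡ᵇ_)
open import Data.Bool using (Bool; true; false; _∧_; if_then_else_)
open import Data.Vec using (Vec; []; _∷_)
open import Data.List using (List; []; _∷_; map; filter; foldr; upTo; _++_)
open import Data.Integer as ℤ using (ℤ)
open import Data.Fin.Subset using (Subset; _∩_; ∣_∣; ∁; ⊤; Nonempty)
open import Data.Product using (_×_; ∃; _,_)
open import Relation.Binary.PropositionalEquality using (_≡_)
open import Relation.Nullary using (¬_)
open import Relation.Nullary.Decidable using (T?)
open import Data.Bool using (T)

-- A lattice path with n steps is a Vec Bool n : true = North step N=(0,1),
-- false = East step E=(1,0).  A subset of the ground set {1,…,n}
-- (here Fin n, i.e. Subset n = Vec Bool n) is identified with the lattice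
-- path whose North steps are exactly at the positions in the subset.

ht : ∀ {n} → Vec Bool n → ℕ → ℕ
ht []       k       = 0
ht (x ∷ xs) zero    = 0
ht (x ∷ xs) (suc k) = (if x then 1 else 0) + ht xs k

IsPath : (m r : ℕ) → Vec Bool (m + r) → Set
IsPath m r P = ht P (m + r) ≡ r

NeverAbove : ∀ {n} → Vec Bool n → Vec Bool n → Set
NeverAbove {n} P Q = ∀ k → k ≤ n → ht P k ≤ ht Q k

allSubsets : (n : ℕ) → List (Subset n)
allSubsets zero    = [] ∷ []
allSubsets (suc n) = map (true ∷_) (allSubsets n) ++ map (false ∷_) (allSubsets n)

allᵇ : {A : Set} → (A → Bool) → List A → Bool
allᵇ p []       = true
allᵇ p (x ∷ xs) = p x ∧ allᵇ p xs

isBasisᵇ : ∀ {n} → ℕ → (P Q B : Vec Bool n) → Bool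
isBasisᵇ {n} r P Q B =
  (∣ B ∣ ≡ᵇ r) ∧ allᵇ (λ k → (ht P k ≤ᵇ ht B k) ∧ (ht B k ≤ᵇ ht Q k)) (upTo (suc n))

bases : (m r : ℕ) → (P Q : Vec Bool (m + r)) → List (Subset (m + r))
bases m r P Q = filter (λ B → T? (isBasisᵇ r P Q B)) (allSubsets (m + r))

rank : (m r : ℕ) → (P Q : Vec Bool (m + r)) → Subset (m + r) → ℕ
rank m r P Q A = foldr _⊔_ 0 (map (λ B → ∣ A ∩ B ∣) (bases m r P Q))

tutte : (m r : ℕ) → (P Q : Vec Bool (m + r)) → ℤ → ℤ → ℤ
tutte m r P Q x y =
  foldr ℤ._+_ (ℤ.+ 0)
    (map (λ A → ((x ℤ.- ℤ.+ 1) ℤ.^ (rk ⊤ ∸ rk A)) ℤ.* ((y ℤ.- ℤ.+ 1) ℤ.^ (∣ A ∣ ∸ rk A)))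
         (allSubsets (m + r)))
  where rk = rank m r P Q

-- M[P,Q] is connected: it is not the direct sum of two nonempty matroids,
-- i.e. there is no partition E = X ⊔ (E∖X) into nonempty parts with
-- r(X) + r(E∖X) = r(E)
Connected : (m r : ℕ) → (P Q : Vec Bool (m + r)) → Set
Connected m r P Q =
  ¬ (∃ λ (X : Subset (m + r)) →
       Nonempty X × Nonempty (∁ X) × (rank m r P Q X + rank m r P Q (∁ X) ≡ rank m r P Q ⊤))

InDiagram : ∀ {n} → (P Q : Vec Bool n) → ℕ → ℕ → Set
InDiagram {n} P Q a b = (a + b ≤ n) × (ht P (a + b) ≤ b) × (b ≤ ht Q (a + b))

OnPath : ∀ {n} → Vec Bool n → ℕ → ℕ → Set
OnPath {n} P a b = (a + b ≤ n) × (ht P (a + b) ≡ b)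

NoInteriorPoints : ∀ {n} → (P Q : Vec Bool n) → Set
NoInteriorPoints P Q =
  ∀ a b → InDiagram P Q a b → ¬ OnPath P a b → ¬ OnPath Q a b → Data.Empty.⊥
  where import Data.Empty

IsSnake : (m r : ℕ) → (P Q : Vec Bool (m + r)) → Set
IsSnake m r P Q = (2 ≤ m + r) × Connected m r P Q × NoInteriorPoints P Q

IsTrivial : (m r : ℕ) → (P Q : Vec Bool (m + r)) → Set
IsTrivial m r P Q =
  ∃ λ (e : m + r ≡ 2) →
    (Relation.Binary.PropositionalEquality.subst (Vec Bool) e P ≡ false ∷ true ∷ [])
    × (Relation.Binary.PropositionalEquality.subst (Vec Bool) e Q ≡ true ∷ false ∷ [])

module Submission where

-- The diagram of a snake is a strip of width one: Q runs exactly one unit above P except at its two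
-- ends.  The bases are the lattice paths inside this strip, and the rank of a set is computed by a
-- two-state scan along P.  Hence T(1,1), T(2,0) and T(0,2) of the path P = E w are read off from six
-- natural numbers attached to w, which obey a simple linear recurrence in the steps of w.  Along this
-- recurrence the quadruple (p, q, X, Y) with p + q = T(1,1) and X + Y = T(2,0) T(0,2) preserves four
-- polynomial inequalities, the last of which is 4 T(1,1)² ≤ 3 T(2,0) T(0,2).

module Snake where

  open import Defs
  open import Data.Nat using (ℕ; zero; suc; _+_; _∸_; _≤_; _≰_; _<_; _⊔_; z≤n; s≤s; _≤?_; _≟_; _≤ᵇ_)
  open import Data.Nat.Properties
  open import Data.Bool using (Bool; true; false; _∧_; _∨_; not; if_then_else_; T)
  open import Data.Bool.Properties using (T-∧)
  open import Data.Vec using (Vec; []; _∷_; here; there)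
  open import Data.List using (List; []; _∷_; map; foldr; applyUpTo)
  open import Data.List.Membership.Propositional using (_∈_)
  open import Data.List.Membership.Propositional.Properties
    using (∈-map⁺; ∈-++⁺ˡ; ∈-++⁺ʳ; ∈-filter⁺; ∈-filter⁻)
  open import Data.List.Relation.Unary.Any using (here; there)
  open import Data.Fin using () renaming (zero to fzero; suc to fsuc)
  open import Data.Fin.Subset using (Subset; _∩_; ∣_∣; ∁; ⊤; Nonempty)
  open import Data.Fin.Subset.Properties using (∣p∩q∣≤∣p∣; ∣p∩q∣≤∣q∣; ∩-identityˡ; ∩-idem)
  open import Data.Product using (_×_; ∃; _,_; proj₁; proj₂)
  open import Data.Sum using (_⊎_; inj₁; inj₂)
  open import Data.Empty using (⊥-elim)
  open import Data.Unit using (tt)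
  open import Function using (_∘_; id)
  open import Function.Bundles using (Equivalence)
  open import Relation.Binary.PropositionalEquality
  open import Relation.Nullary using (¬_; yes; no)
  open import Relation.Nullary.Decidable using (T?)

  bit : Bool → ℕ
  bit b = if b then 1 else 0

  ht≤ : ∀ {n} (v : Vec Bool n) k → ht v k ≤ k
  ht≤ []          k       = z≤n
  ht≤ (x ∷ v)     zero    = z≤n
  ht≤ (true ∷ v)  (suc k) = s≤s (ht≤ v k)
  ht≤ (false ∷ v) (suc k) = m≤n⇒m≤1+n (ht≤ v k)

  ht-zero : ∀ {n} (v : Vec Bool n) → ht v 0 ≡ 0
  ht-zero []      = refl
  ht-zero (x ∷ v) = refl

  ∣∣≡ht : ∀ {n} (B : Subset n) → ∣ B ∣ ≡ ht B n
  ∣∣≡ht []          = refl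
  ∣∣≡ht (true ∷ B)  = cong suc (∣∣≡ht B)
  ∣∣≡ht (false ∷ B) = ∣∣≡ht B

  last : ∀ {k} → Vec Bool (suc k) → Bool
  last (x ∷ [])     = x
  last (x ∷ y ∷ ys) = last (y ∷ ys)

  ht-last : ∀ {k} (v : Vec Bool (suc k)) → ht v (suc k) ≡ ht v k + bit (last v)
  ht-last (x ∷ [])     = +-comm (bit x) 0
  ht-last (x ∷ y ∷ ys) = trans (cong (bit x +_) (ht-last (y ∷ ys))) (sym (+-assoc (bit x) _ _))

  module _ {A : Set} (f : A → ℕ) where

    maximum-≤ : ∀ {v} (xs : List A) → (∀ {x} → x ∈ xs → f x ≤ v) → foldr _⊔_ 0 (map f xs) ≤ v
    maximum-≤ []       h = z≤n
    maximum-≤ (x ∷ xs) h = ⊔-lub (h (here refl)) (maximum-≤ xs (h ∘ there))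

    ≤-maximum : ∀ {x} (xs : List A) → x ∈ xs → f x ≤ foldr _⊔_ 0 (map f xs)
    ≤-maximum (y ∷ xs) (here refl) = m≤m⊔n _ _
    ≤-maximum (y ∷ xs) (there x∈xs) = ≤-trans (≤-maximum xs x∈xs) (m≤n⊔m _ _)

  ∈-allSubsets : ∀ n (B : Subset n) → B ∈ allSubsets n
  ∈-allSubsets zero    []          = here refl
  ∈-allSubsets (suc n) (true ∷ B)  = ∈-++⁺ˡ (∈-map⁺ (true ∷_) (∈-allSubsets n B))
  ∈-allSubsets (suc n) (false ∷ B) =
    ∈-++⁺ʳ (map (true ∷_) (allSubsets n)) (∈-map⁺ (false ∷_) (∈-allSubsets n B))

  allᵇ-applyUpTo⁻ : ∀ (p : ℕ → Bool) (f : ℕ → ℕ) n →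
                    T (allᵇ p (applyUpTo f n)) → ∀ k → k < n → T (p (f k))
  allᵇ-applyUpTo⁻ p f (suc n) t zero    _         = proj₁ (Equivalence.to T-∧ t)
  allᵇ-applyUpTo⁻ p f (suc n) t (suc k) (s≤s k<n) =
    allᵇ-applyUpTo⁻ p (f ∘ suc) n (proj₂ (Equivalence.to T-∧ t)) k k<n

  allᵇ-applyUpTo⁺ : ∀ (p : ℕ → Bool) (f : ℕ → ℕ) n →
                    (∀ k → k < n → T (p (f k))) → T (allᵇ p (applyUpTo f n))
  allᵇ-applyUpTo⁺ p f zero    h = tt
  allᵇ-applyUpTo⁺ p f (suc n) h = Equivalence.from T-∧
    (h zero (s≤s z≤n) , allᵇ-applyUpTo⁺ p (f ∘ suc) n (λ k k<n → h (suc k) (s≤s k<n)))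

  Between : ∀ {n} → (P Q B : Vec Bool n) → Set
  Between {n} P Q B = ∀ k → k ≤ n → ht P k ≤ ht B k × ht B k ≤ ht Q k

  IsBasis : ∀ {n} → ℕ → (P Q B : Vec Bool n) → Set
  IsBasis r P Q B = ∣ B ∣ ≡ r × Between P Q B

  ∈bases⇒IsBasis : ∀ {m r} (P Q : Vec Bool (m + r)) {B} → B ∈ bases m r P Q → IsBasis r P Q B
  ∈bases⇒IsBasis {m} {r} P Q B∈bases =
    ≡ᵇ⇒≡ _ _ (proj₁ t) , λ k k≤n →
      let u = Equivalence.to T-∧ (allᵇ-applyUpTo⁻ _ id (suc (m + r)) (proj₂ t) k (s≤s k≤n))
      in ≤ᵇ⇒≤ _ _ (proj₁ u) , ≤ᵇ⇒≤ _ _ (proj₂ u)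
    where
    t = Equivalence.to T-∧ (proj₂ (∈-filter⁻ (λ B → T? (isBasisᵇ r P Q B)) {xs = allSubsets (m + r)} B∈bases))

  IsBasis⇒∈bases : ∀ {m r} (P Q : Vec Bool (m + r)) {B} → IsBasis r P Q B → B ∈ bases m r P Q
  IsBasis⇒∈bases {m} {r} P Q {B} (∣B∣≡r , between) =
    ∈-filter⁺ (λ B → T? (isBasisᵇ r P Q B)) (∈-allSubsets (m + r) B) (Equivalence.from T-∧
      (≡⇒≡ᵇ _ _ ∣B∣≡r , allᵇ-applyUpTo⁺ _ id (suc (m + r)) λ k k<n →
         let (lower , upper) = between k (≤-pred k<n)
         in Equivalence.from T-∧ (≤⇒≤ᵇ lower , ≤⇒≤ᵇ upper)))

  rank-≡ : ∀ {m r} (P Q : Vec Bool (m + r)) A {c} →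
           (∀ B → IsBasis r P Q B → ∣ A ∩ B ∣ ≤ c) →
           (∃ λ B → IsBasis r P Q B × c ≤ ∣ A ∩ B ∣) → rank m r P Q A ≡ c
  rank-≡ {m} {r} P Q A bounded (B , isBasis , attained) = ≤-antisym
    (maximum-≤ (λ B → ∣ A ∩ B ∣) (bases m r P Q) (λ {B} → bounded B ∘ ∈bases⇒IsBasis P Q))
    (≤-trans attained (≤-maximum (λ B → ∣ A ∩ B ∣) (bases m r P Q) (IsBasis⇒∈bases P Q isBasis)))

  record UnitStrip {n} (P Q : Vec Bool n) : Set where
    field
      upper    : ∀ k → k ≤ n → ht Q k ≤ suc (ht P k)
      interior : ∀ k → 0 < k → k < n → ht Q k ≡ suc (ht P k)
      end      : ht Q n ≡ ht P n

  noInteriorPoints⇒ht≤1+ht : ∀ {n} (P Q : Vec Bool n) → NoInteriorPoints P Q →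
                              ∀ k → k ≤ n → ht Q k ≤ suc (ht P k)
  noInteriorPoints⇒ht≤1+ht {n} P Q noInterior k k≤n with ht Q k ≤? suc (ht P k)
  ... | yes Qₖ≤1+Pₖ = Qₖ≤1+Pₖ
  ... | no Qₖ≰1+Pₖ = ⊥-elim (noInterior (k ∸ b) b inDiagram notOnP notOnQ)
    where
    b = suc (ht P k)
    2+Pₖ≤Qₖ : suc b ≤ ht Q k
    2+Pₖ≤Qₖ = ≰⇒> Qₖ≰1+Pₖ
    a+b≡k : k ∸ b + b ≡ k
    a+b≡k = m∸n+n≡m (≤-trans (≤-trans (n≤1+n b) 2+Pₖ≤Qₖ) (ht≤ Q k))
    inDiagram : InDiagram P Q (k ∸ b) b
    inDiagram rewrite a+b≡k = k≤n , n≤1+n _ , ≤-trans (n≤1+n b) 2+Pₖ≤Qₖ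
    notOnP : ¬ OnPath P (k ∸ b) b
    notOnP (_ , Pₖ≡b) rewrite a+b≡k = 1+n≢n (sym Pₖ≡b)
    notOnQ : ¬ OnPath Q (k ∸ b) b
    notOnQ (_ , Qₖ≡b) rewrite a+b≡k = 1+n≰n (subst (suc b ≤_) Qₖ≡b 2+Pₖ≤Qₖ)

  prefix : ∀ n → ℕ → Subset n
  prefix zero    k       = []
  prefix (suc n) zero    = false ∷ prefix n zero
  prefix (suc n) (suc k) = true ∷ prefix n k

  ∣prefix∩∣≡ht : ∀ {n} k (B : Subset n) → ∣ prefix n k ∩ B ∣ ≡ ht B k
  ∣prefix∩∣≡ht k       []          = refl
  ∣prefix∩∣≡ht zero    (b ∷ B)     = trans (∣prefix∩∣≡ht zero B) (ht-zero B)
  ∣prefix∩∣≡ht (suc k) (true ∷ B)  = cong suc (∣prefix∩∣≡ht k B)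
  ∣prefix∩∣≡ht (suc k) (false ∷ B) = ∣prefix∩∣≡ht k B

  prefix-nonempty : ∀ n k → 0 < k → 0 < n → Nonempty (prefix n k)
  prefix-nonempty (suc n) (suc k) _ _ = fzero , here

  ∁prefix-nonempty : ∀ n k → k < n → Nonempty (∁ (prefix n k))
  ∁prefix-nonempty (suc n) zero    _         = fzero , here
  ∁prefix-nonempty (suc n) (suc k) (s≤s k<n) =
    let (i , i∈∁prefix) = ∁prefix-nonempty n k k<n in fsuc i , there i∈∁prefix

  ∣∩∣+∣∁∩∣≡∣∣ : ∀ {n} (X B : Subset n) → ∣ X ∩ B ∣ + ∣ ∁ X ∩ B ∣ ≡ ∣ B ∣
  ∣∩∣+∣∁∩∣≡∣∣ []          []          = refl
  ∣∩∣+∣∁∩∣≡∣∣ (true ∷ X)  (true ∷ B)  = cong suc (∣∩∣+∣∁∩∣≡∣∣ X B)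
  ∣∩∣+∣∁∩∣≡∣∣ (false ∷ X) (true ∷ B)  = trans (+-suc _ _) (cong suc (∣∩∣+∣∁∩∣≡∣∣ X B))
  ∣∩∣+∣∁∩∣≡∣∣ (true ∷ X)  (false ∷ B) = ∣∩∣+∣∁∩∣≡∣∣ X B
  ∣∩∣+∣∁∩∣≡∣∣ (false ∷ X) (false ∷ B) = ∣∩∣+∣∁∩∣≡∣∣ X B

  path-isBasis : ∀ {m r} (P Q : Vec Bool (m + r)) → IsPath m r P → NeverAbove P Q → IsBasis r P Q P
  path-isBasis P Q isPath P≤Q = trans (∣∣≡ht P) isPath , λ k k≤n → ≤-refl , P≤Q k k≤n

  -- If Q touched P at an interior k, every basis would have exactly ht P k elements among the first k,
  -- so the first k elements would separate the matroid.
  connected⇒ht≢ht : ∀ {m r} (P Q : Vec Bool (m + r)) → IsPath m r P → NeverAbove P Q →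
                    Connected m r P Q → ∀ k → 0 < k → k < m + r → ht Q k ≢ ht P k
  connected⇒ht≢ht {m} {r} P Q isPath P≤Q connected k 0<k k<n Qₖ≡Pₖ = connected
    (X , prefix-nonempty (m + r) k 0<k (<-trans 0<k k<n) , ∁prefix-nonempty (m + r) k k<n , separated)
    where
    open ≡-Reasoning
    X = prefix (m + r) k
    basisP = path-isBasis P Q isPath P≤Q

    ∣X∩B∣≡Pₖ : ∀ B → IsBasis r P Q B → ∣ X ∩ B ∣ ≡ ht P k
    ∣X∩B∣≡Pₖ B (_ , between) =
      let (lower , upper) = between k (<⇒≤ k<n)
      in trans (∣prefix∩∣≡ht k B) (≤-antisym (subst (ht B k ≤_) Qₖ≡Pₖ upper) lower)

    ∣∁X∩B∣≡r∸Pₖ : ∀ B → IsBasis r P Q B → ∣ ∁ X ∩ B ∣ ≡ r ∸ ht P k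
    ∣∁X∩B∣≡r∸Pₖ B basis@(∣B∣≡r , _) = begin
      ∣ ∁ X ∩ B ∣                           ≡⟨ m+n∸m≡n ∣ X ∩ B ∣ _ ⟨
      ∣ X ∩ B ∣ + ∣ ∁ X ∩ B ∣ ∸ ∣ X ∩ B ∣  ≡⟨ cong₂ _∸_ (∣∩∣+∣∁∩∣≡∣∣ X B) (∣X∩B∣≡Pₖ B basis) ⟩
      ∣ B ∣ ∸ ht P k                        ≡⟨ cong (_∸ ht P k) ∣B∣≡r ⟩
      r ∸ ht P k                            ∎

    rank-constant : ∀ A {c} → (∀ B → IsBasis r P Q B → ∣ A ∩ B ∣ ≡ c) → rank m r P Q A ≡ c
    rank-constant A const =
      rank-≡ P Q A (λ B → ≤-reflexive ∘ const B) (P , basisP , ≤-reflexive (sym (const P basisP)))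

    Pₖ≤r : ht P k ≤ r
    Pₖ≤r = subst₂ _≤_ (∣X∩B∣≡Pₖ P basisP) (proj₁ basisP) (∣p∩q∣≤∣q∣ X P)

    separated : rank m r P Q X + rank m r P Q (∁ X) ≡ rank m r P Q ⊤
    separated = begin
      rank m r P Q X + rank m r P Q (∁ X)
        ≡⟨ cong₂ _+_ (rank-constant X ∣X∩B∣≡Pₖ) (rank-constant (∁ X) ∣∁X∩B∣≡r∸Pₖ) ⟩
      ht P k + (r ∸ ht P k)
        ≡⟨ m+[n∸m]≡n Pₖ≤r ⟩
      r
        ≡⟨ rank-constant ⊤ (λ B (∣B∣≡r , _) → trans (cong ∣_∣ (∩-identityˡ B)) ∣B∣≡r) ⟨
      rank m r P Q ⊤
        ∎

  snake⇒UnitStrip : ∀ {m r} (P Q : Vec Bool (m + r)) → IsPath m r P → IsPath m r Q →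
                    NeverAbove P Q → IsSnake m r P Q → UnitStrip P Q
  snake⇒UnitStrip P Q isPathP isPathQ P≤Q (_ , connected , noInterior) = record
    { upper    = upper
    ; interior = λ k 0<k k<n → ≤-antisym (upper k (<⇒≤ k<n))
        (≤∧≢⇒< (P≤Q k (<⇒≤ k<n)) (connected⇒ht≢ht P Q isPathP P≤Q connected k 0<k k<n ∘ sym))
    ; end      = trans isPathQ (sym isPathP)
    }
    where upper = noInteriorPoints⇒ht≤1+ht P Q noInterior

  -- The state s is how far B runs above P, which must stay 0 or 1 and end at 0.
  inStripᵇ : ∀ {n} → Bool → Vec Bool n → Vec Bool n → Bool
  inStripᵇ s     []           []           = not s
  inStripᵇ false (false ∷ ps) (false ∷ bs) = inStripᵇ false ps bs
  inStripᵇ false (false ∷ ps) (true ∷ bs)  = inStripᵇ true ps bs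
  inStripᵇ false (true ∷ ps)  (false ∷ bs) = false
  inStripᵇ false (true ∷ ps)  (true ∷ bs)  = inStripᵇ false ps bs
  inStripᵇ true  (false ∷ ps) (false ∷ bs) = inStripᵇ true ps bs
  inStripᵇ true  (false ∷ ps) (true ∷ bs)  = false
  inStripᵇ true  (true ∷ ps)  (false ∷ bs) = inStripᵇ false ps bs
  inStripᵇ true  (true ∷ ps)  (true ∷ bs)  = inStripᵇ true ps bs

  InStrip : ∀ {n} → Bool → Vec Bool n → Vec Bool n → Set
  InStrip {n} s P B =
    (∀ k → k ≤ n → ht P k ≤ bit s + ht B k × bit s + ht B k ≤ suc (ht P k)) × (bit s + ht B n ≤ ht P n)

  bit≤1 : ∀ b → bit b ≤ 1
  bit≤1 true  = ≤-refl
  bit≤1 false = z≤n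

  module _ {n} {s s′ p b : Bool} {ps bs : Vec Bool n} (balance : bit s + bit b ≡ bit p + bit s′) where

    private
      shifted : ∀ k → bit s + ht (b ∷ bs) (suc k) ≡ bit p + (bit s′ + ht bs k)
      shifted k = trans (sym (+-assoc (bit s) (bit b) _))
                        (trans (cong (_+ ht bs k) balance) (+-assoc (bit p) (bit s′) _))

    InStrip-∷⁺ : InStrip s′ ps bs → InStrip s (p ∷ ps) (b ∷ bs)
    InStrip-∷⁺ (within , final) =
      within′ , subst (_≤ bit p + ht ps n) (sym (shifted n)) (+-monoʳ-≤ (bit p) final)
      where
      within′ : ∀ k → k ≤ suc n →
                ht (p ∷ ps) k ≤ bit s + ht (b ∷ bs) k × bit s + ht (b ∷ bs) k ≤ suc (ht (p ∷ ps) k)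
      within′ zero    _         = z≤n , subst (_≤ 1) (sym (+-identityʳ (bit s))) (bit≤1 s)
      within′ (suc k) (s≤s k≤n) rewrite shifted k =
        let (lower , upper) = within k k≤n
        in +-monoʳ-≤ (bit p) lower ,
           subst (bit p + (bit s′ + ht bs k) ≤_) (+-suc (bit p) (ht ps k)) (+-monoʳ-≤ (bit p) upper)

    InStrip-∷⁻ : InStrip s (p ∷ ps) (b ∷ bs) → InStrip s′ ps bs
    InStrip-∷⁻ (within , final) =
      within′ , +-cancelˡ-≤ (bit p) _ _ (subst (_≤ bit p + ht ps n) (shifted n) final)
      where
      within′ : ∀ k → k ≤ n → ht ps k ≤ bit s′ + ht bs k × bit s′ + ht bs k ≤ suc (ht ps k)
      within′ k k≤n with within (suc k) (s≤s k≤n)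
      ... | lower , upper rewrite shifted k =
        +-cancelˡ-≤ (bit p) _ _ lower ,
        +-cancelˡ-≤ (bit p) _ _ (subst (bit p + (bit s′ + ht bs k) ≤_) (sym (+-suc (bit p) (ht ps k))) upper)

  inStripᵇ⇒InStrip : ∀ {n} s (P B : Vec Bool n) → T (inStripᵇ s P B) → InStrip s P B
  inStripᵇ⇒InStrip false []           []           t = (λ { zero _ → z≤n , z≤n }) , z≤n
  inStripᵇ⇒InStrip true  []           []           ()
  inStripᵇ⇒InStrip false (false ∷ ps) (false ∷ bs) t = InStrip-∷⁺ refl (inStripᵇ⇒InStrip false ps bs t)
  inStripᵇ⇒InStrip false (false ∷ ps) (true ∷ bs)  t = InStrip-∷⁺ refl (inStripᵇ⇒InStrip true ps bs t)
  inStripᵇ⇒InStrip false (true ∷ ps)  (false ∷ bs) ()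
  inStripᵇ⇒InStrip false (true ∷ ps)  (true ∷ bs)  t = InStrip-∷⁺ refl (inStripᵇ⇒InStrip false ps bs t)
  inStripᵇ⇒InStrip true  (false ∷ ps) (false ∷ bs) t = InStrip-∷⁺ refl (inStripᵇ⇒InStrip true ps bs t)
  inStripᵇ⇒InStrip true  (false ∷ ps) (true ∷ bs)  ()
  inStripᵇ⇒InStrip true  (true ∷ ps)  (false ∷ bs) t = InStrip-∷⁺ refl (inStripᵇ⇒InStrip false ps bs t)
  inStripᵇ⇒InStrip true  (true ∷ ps)  (true ∷ bs)  t = InStrip-∷⁺ refl (inStripᵇ⇒InStrip true ps bs t)

  private
    suc-ht₀≰ht₀ : ∀ {m n} (u : Vec Bool m) (v : Vec Bool n) → suc (ht u 0) ≰ ht v 0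
    suc-ht₀≰ht₀ u v rewrite ht-zero u | ht-zero v = λ ()

  InStrip⇒inStripᵇ : ∀ {n} s (P B : Vec Bool n) → InStrip s P B → T (inStripᵇ s P B)
  InStrip⇒inStripᵇ false []           []           _            = tt
  InStrip⇒inStripᵇ true  []           []           (_ , ())
  InStrip⇒inStripᵇ false (false ∷ ps) (false ∷ bs) h            = InStrip⇒inStripᵇ false ps bs (InStrip-∷⁻ refl h)
  InStrip⇒inStripᵇ false (false ∷ ps) (true ∷ bs)  h            = InStrip⇒inStripᵇ true ps bs (InStrip-∷⁻ refl h)
  InStrip⇒inStripᵇ false (true ∷ ps)  (false ∷ bs) (within , _) =
    ⊥-elim (suc-ht₀≰ht₀ ps bs (proj₁ (within 1 (s≤s z≤n))))
  InStrip⇒inStripᵇ false (true ∷ ps)  (true ∷ bs)  h            = InStrip⇒inStripᵇ false ps bs (InStrip-∷⁻ refl h)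
  InStrip⇒inStripᵇ true  (false ∷ ps) (false ∷ bs) h            = InStrip⇒inStripᵇ true ps bs (InStrip-∷⁻ refl h)
  InStrip⇒inStripᵇ true  (false ∷ ps) (true ∷ bs)  (within , _) =
    ⊥-elim (suc-ht₀≰ht₀ bs ps (≤-pred (proj₂ (within 1 (s≤s z≤n)))))
  InStrip⇒inStripᵇ true  (true ∷ ps)  (false ∷ bs) h            = InStrip⇒inStripᵇ false ps bs (InStrip-∷⁻ refl h)
  InStrip⇒inStripᵇ true  (true ∷ ps)  (true ∷ bs)  h            = InStrip⇒inStripᵇ true ps bs (InStrip-∷⁻ refl h)

  InStrip⇒∣∣≡∣∣ : ∀ {n} s (P B : Vec Bool n) → InStrip s P B → bit s + ∣ B ∣ ≡ ∣ P ∣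
  InStrip⇒∣∣≡∣∣ {n} s P B (within , final) = begin
    bit s + ∣ B ∣   ≡⟨ cong (bit s +_) (∣∣≡ht B) ⟩
    bit s + ht B n  ≡⟨ ≤-antisym final (proj₁ (within n ≤-refl)) ⟩
    ht P n          ≡⟨ ∣∣≡ht P ⟨
    ∣ P ∣           ∎
    where open ≡-Reasoning

  inStripᵇ⇒∣∣≡∣∣ : ∀ {n} s (P B : Vec Bool n) → T (inStripᵇ s P B) → bit s + ∣ B ∣ ≡ ∣ P ∣
  inStripᵇ⇒∣∣≡∣∣ s P B = InStrip⇒∣∣≡∣∣ s P B ∘ inStripᵇ⇒InStrip s P B

  module _ {n r} {P Q : Vec Bool n} (strip : UnitStrip P Q) (Pₙ≡r : ht P n ≡ r) where

    IsBasis⇒inStripᵇ : ∀ B → IsBasis r P Q B → T (inStripᵇ false P B)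
    IsBasis⇒inStripᵇ B (∣B∣≡r , between) = InStrip⇒inStripᵇ false P B
      ( (λ k k≤n → let (lower , upper) = between k k≤n
                   in lower , ≤-trans upper (UnitStrip.upper strip k k≤n))
      , ≤-reflexive (trans (sym (∣∣≡ht B)) (trans ∣B∣≡r (sym Pₙ≡r))))

    inStripᵇ⇒IsBasis : ∀ B → T (inStripᵇ false P B) → IsBasis r P Q B
    inStripᵇ⇒IsBasis B t =
      trans (inStripᵇ⇒∣∣≡∣∣ false P B t) (trans (∣∣≡ht P) Pₙ≡r) ,
      λ k k≤n → proj₁ (proj₁ inStrip k k≤n) , B≤Q k k≤n
      where
      inStrip = inStripᵇ⇒InStrip false P B t
      B≤Q : ∀ k → k ≤ n → ht B k ≤ ht Q k
      B≤Q zero    _   = subst (_≤ ht Q 0) (sym (ht-zero B)) z≤n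
      B≤Q (suc k) k<n with suc k ≟ n
      ... | yes refl = subst (ht B (suc k) ≤_) (sym (UnitStrip.end strip)) (proj₂ inStrip)
      ... | no  k≢n  = subst (ht B (suc k) ≤_)
                             (sym (UnitStrip.interior strip (suc k) (s≤s z≤n) (≤∧≢⇒< k<n k≢n)))
                             (proj₂ (proj₁ inStrip (suc k) k<n))

  -- stripRank D P A is the maximum of |A ∩ B| over B with inStripᵇ false P B and, when D holds,
  -- of 1 + |A ∩ B| over B with inStripᵇ true P B.
  stripRank : ∀ {n} → Bool → Vec Bool n → Subset n → ℕ
  stripRank D []           []       = 0
  stripRank D (false ∷ ps) (a ∷ as) = stripRank (a ∨ D) ps as
  stripRank D (true ∷ ps)  (a ∷ as) = bit (a ∨ D) + stripRank (a ∧ D) ps as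

  private
    carry : ∀ c₁ c₂ c₃ {x y} → T (c₁ ≤ᵇ c₂ + c₃) → c₃ + x ≤ y → c₁ + x ≤ c₂ + y
    carry c₁ c₂ c₃ {x} {y} c₁≤c₂+c₃ c₃+x≤y = ≤-trans (+-monoˡ-≤ x (≤ᵇ⇒≤ c₁ (c₂ + c₃) c₁≤c₂+c₃))
      (subst (_≤ c₂ + y) (sym (+-assoc c₂ c₃ x)) (+-monoʳ-≤ c₂ c₃+x≤y))

  ∣∩∣≤stripRank : ∀ {n} s D (P B A : Vec Bool n) → T (inStripᵇ s P B) →
                  bit (s ∧ D) + ∣ A ∩ B ∣ ≤ stripRank D P A
  ∣∩∣≤stripRank false D     []           []           []           t  = z≤n
  ∣∩∣≤stripRank true  D     []           []           []           ()
  ∣∩∣≤stripRank false D     (true ∷ ps)  (false ∷ bs) A            ()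
  ∣∩∣≤stripRank true  D     (false ∷ ps) (true ∷ bs)  A            ()
  ∣∩∣≤stripRank false D     (false ∷ ps) (false ∷ bs) (false ∷ as) t  = ∣∩∣≤stripRank false _ ps bs as t
  ∣∩∣≤stripRank false D     (false ∷ ps) (false ∷ bs) (true ∷ as)  t  = ∣∩∣≤stripRank false _ ps bs as t
  ∣∩∣≤stripRank false false (false ∷ ps) (true ∷ bs)  (false ∷ as) t  = carry 0 0 0 tt (∣∩∣≤stripRank true _ ps bs as t)
  ∣∩∣≤stripRank false true  (false ∷ ps) (true ∷ bs)  (false ∷ as) t  = carry 0 0 1 tt (∣∩∣≤stripRank true _ ps bs as t)
  ∣∩∣≤stripRank false D     (false ∷ ps) (true ∷ bs)  (true ∷ as)  t  = carry 1 0 1 tt (∣∩∣≤stripRank true _ ps bs as t)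
  ∣∩∣≤stripRank false false (true ∷ ps)  (true ∷ bs)  (false ∷ as) t  = carry 0 0 0 tt (∣∩∣≤stripRank false _ ps bs as t)
  ∣∩∣≤stripRank false true  (true ∷ ps)  (true ∷ bs)  (false ∷ as) t  = carry 0 1 0 tt (∣∩∣≤stripRank false _ ps bs as t)
  ∣∩∣≤stripRank false D     (true ∷ ps)  (true ∷ bs)  (true ∷ as)  t  = carry 1 1 0 tt (∣∩∣≤stripRank false _ ps bs as t)
  ∣∩∣≤stripRank true  false (false ∷ ps) (false ∷ bs) (false ∷ as) t  = carry 0 0 0 tt (∣∩∣≤stripRank true _ ps bs as t)
  ∣∩∣≤stripRank true  false (false ∷ ps) (false ∷ bs) (true ∷ as)  t  = carry 0 0 1 tt (∣∩∣≤stripRank true _ ps bs as t)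
  ∣∩∣≤stripRank true  true  (false ∷ ps) (false ∷ bs) (false ∷ as) t  = carry 1 0 1 tt (∣∩∣≤stripRank true _ ps bs as t)
  ∣∩∣≤stripRank true  true  (false ∷ ps) (false ∷ bs) (true ∷ as)  t  = carry 1 0 1 tt (∣∩∣≤stripRank true _ ps bs as t)
  ∣∩∣≤stripRank true  false (true ∷ ps)  (false ∷ bs) (false ∷ as) t  = carry 0 0 0 tt (∣∩∣≤stripRank false _ ps bs as t)
  ∣∩∣≤stripRank true  false (true ∷ ps)  (false ∷ bs) (true ∷ as)  t  = carry 0 1 0 tt (∣∩∣≤stripRank false _ ps bs as t)
  ∣∩∣≤stripRank true  true  (true ∷ ps)  (false ∷ bs) (false ∷ as) t  = carry 1 1 0 tt (∣∩∣≤stripRank false _ ps bs as t)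
  ∣∩∣≤stripRank true  true  (true ∷ ps)  (false ∷ bs) (true ∷ as)  t  = carry 1 1 0 tt (∣∩∣≤stripRank false _ ps bs as t)
  ∣∩∣≤stripRank true  false (true ∷ ps)  (true ∷ bs)  (false ∷ as) t  = carry 0 0 0 tt (∣∩∣≤stripRank true _ ps bs as t)
  ∣∩∣≤stripRank true  false (true ∷ ps)  (true ∷ bs)  (true ∷ as)  t  = carry 1 1 0 tt (∣∩∣≤stripRank true _ ps bs as t)
  ∣∩∣≤stripRank true  true  (true ∷ ps)  (true ∷ bs)  (false ∷ as) t  = carry 1 1 0 tt (∣∩∣≤stripRank true _ ps bs as t)
  ∣∩∣≤stripRank true  true  (true ∷ ps)  (true ∷ bs)  (true ∷ as)  t  = carry 2 1 1 tt (∣∩∣≤stripRank true _ ps bs as t)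

  stripRank-attained : ∀ {n} D (P A : Vec Bool n) →
    (∃ λ B → T (inStripᵇ false P B) × stripRank D P A ≤ ∣ A ∩ B ∣) ⊎
    (T D × ∃ λ B → T (inStripᵇ true P B) × stripRank D P A ≤ suc ∣ A ∩ B ∣)
  stripRank-attained D [] [] = inj₁ ([] , tt , z≤n)
  stripRank-attained D (false ∷ ps) (false ∷ as) with stripRank-attained D ps as
  ... | inj₁ (B , t , le)      = inj₁ (false ∷ B , t , le)
  ... | inj₂ (d , B , t , le)  = inj₂ (d , false ∷ B , t , le)
  stripRank-attained D (false ∷ ps) (true ∷ as) with stripRank-attained true ps as
  ... | inj₁ (B , t , le)      = inj₁ (false ∷ B , t , le)
  ... | inj₂ (_ , B , t , le)  = inj₁ (true ∷ B , t , le)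
  stripRank-attained true (true ∷ ps) (true ∷ as) with stripRank-attained true ps as
  ... | inj₁ (B , t , le)      = inj₁ (true ∷ B , t , s≤s le)
  ... | inj₂ (_ , B , t , le)  = inj₂ (tt , true ∷ B , t , s≤s le)
  stripRank-attained false (true ∷ ps) (true ∷ as) with stripRank-attained false ps as
  ... | inj₁ (B , t , le)      = inj₁ (true ∷ B , t , s≤s le)
  ... | inj₂ (() , _)
  stripRank-attained false (true ∷ ps) (false ∷ as) with stripRank-attained false ps as
  ... | inj₁ (B , t , le)      = inj₁ (true ∷ B , t , le)
  ... | inj₂ (() , _)
  stripRank-attained true (true ∷ ps) (false ∷ as) with stripRank-attained false ps as
  ... | inj₁ (B , t , le)      = inj₂ (tt , false ∷ B , t , s≤s le)
  ... | inj₂ (() , _)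

  stripRank-witness : ∀ {n} (P A : Vec Bool n) → ∃ λ B → T (inStripᵇ false P B) × stripRank false P A ≤ ∣ A ∩ B ∣
  stripRank-witness P A with stripRank-attained false P A
  ... | inj₁ witness = witness
  ... | inj₂ (() , _)

  rank≡stripRank : ∀ {m r} (P Q : Vec Bool (m + r)) → UnitStrip P Q → IsPath m r P →
                   ∀ A → rank m r P Q A ≡ stripRank false P A
  rank≡stripRank P Q strip isPath A =
    let (B , t , attained) = stripRank-witness P A in
    rank-≡ P Q A (λ B′ → ∣∩∣≤stripRank false false P B′ A ∘ IsBasis⇒inStripᵇ strip isPath B′)
                 (B , inStripᵇ⇒IsBasis strip isPath B t , attained)

  stripRank-⊤ : ∀ {n} D (P : Vec Bool n) → stripRank D P ⊤ ≡ ∣ P ∣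
  stripRank-⊤ D []          = refl
  stripRank-⊤ D (false ∷ P) = stripRank-⊤ true P
  stripRank-⊤ D (true ∷ P)  = cong suc (stripRank-⊤ D P)

  stripRank≤∣∣ : ∀ {n} (P A : Vec Bool n) → stripRank false P A ≤ ∣ A ∣
  stripRank≤∣∣ P A =
    let (B , _ , attained) = stripRank-witness P A in ≤-trans attained (∣p∩q∣≤∣p∣ A B)

  stripRank≤∣P∣ : ∀ {n} (P A : Vec Bool n) → stripRank false P A ≤ ∣ P ∣
  stripRank≤∣P∣ P A =
    let (B , t , attained) = stripRank-witness P A
    in ≤-trans attained (≤-trans (∣p∩q∣≤∣q∣ A B) (≤-reflexive (inStripᵇ⇒∣∣≡∣∣ false P B t)))

  ∣∩∣≡∣∣⇒≡ : ∀ {n} (A B : Subset n) → ∣ A ∩ B ∣ ≡ ∣ A ∣ → ∣ A ∣ ≡ ∣ B ∣ → A ≡ B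
  ∣∩∣≡∣∣⇒≡ []          []          _ _ = refl
  ∣∩∣≡∣∣⇒≡ (true ∷ A)  (true ∷ B)  e₁ e₂ = cong (true ∷_) (∣∩∣≡∣∣⇒≡ A B (suc-injective e₁) (suc-injective e₂))
  ∣∩∣≡∣∣⇒≡ (false ∷ A) (false ∷ B) e₁ e₂ = cong (false ∷_) (∣∩∣≡∣∣⇒≡ A B e₁ e₂)
  ∣∩∣≡∣∣⇒≡ (true ∷ A)  (false ∷ B) e₁ e₂ = ⊥-elim (1+n≰n (subst (_≤ ∣ A ∣) e₁ (∣p∩q∣≤∣p∣ A B)))
  ∣∩∣≡∣∣⇒≡ (false ∷ A) (true ∷ B)  e₁ e₂ = ⊥-elim (1+n≰n (subst (_≤ ∣ B ∣) (trans e₁ e₂) (∣p∩q∣≤∣q∣ A B)))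

  full⇒inStripᵇ : ∀ {n} (P A : Vec Bool n) → ∣ P ∣ ≤ stripRank false P A → ∣ A ∣ ≤ stripRank false P A →
                  T (inStripᵇ false P A)
  full⇒inStripᵇ P A spanning independent =
    let (B , t , attained) = stripRank-witness P A
        ∣A∩B∣≡∣A∣ = ≤-antisym (∣p∩q∣≤∣p∣ A B) (≤-trans independent attained)
        ∣A∣≡∣B∣   = ≤-antisym (subst (_≤ ∣ B ∣) ∣A∩B∣≡∣A∣ (∣p∩q∣≤∣q∣ A B))
                              (≤-trans (≤-reflexive (inStripᵇ⇒∣∣≡∣∣ false P B t))
                                       (≤-trans spanning (stripRank≤∣∣ P A)))
    in subst (T ∘ inStripᵇ false P) (sym (∣∩∣≡∣∣⇒≡ A B ∣A∩B∣≡∣A∣ ∣A∣≡∣B∣)) t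

  inStripᵇ⇒full : ∀ {n} (P A : Vec Bool n) → T (inStripᵇ false P A) →
                  ∣ P ∣ ≤ stripRank false P A × ∣ A ∣ ≤ stripRank false P A
  inStripᵇ⇒full P A t =
    ≤-trans (≤-reflexive (sym (inStripᵇ⇒∣∣≡∣∣ false P A t))) independent , independent
    where
    independent : ∣ A ∣ ≤ stripRank false P A
    independent = subst (_≤ stripRank false P A) (cong ∣_∣ (∩-idem A)) (∣∩∣≤stripRank false false P A A t)

  unitStrip-head : ∀ {k p} {ps : Vec Bool (suc k)} {Q} → UnitStrip (p ∷ ps) Q → p ≡ false
  unitStrip-head {p = false} strip = refl
  unitStrip-head {p = true} {Q = Q} strip
    with ≤-pred (subst (_≤ 1) (UnitStrip.interior strip 1 (s≤s z≤n) (s≤s (s≤s z≤n))) (ht≤ Q 1))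
  ... | ()

  unitStrip-last : ∀ {n} (P Q : Vec Bool (suc n)) → UnitStrip P Q → 0 < n → last P ≡ true
  unitStrip-last {n} P Q strip 0<n with last P in lastP
  ... | true  = refl
  ... | false = ⊥-elim (1+n≰n (begin
    suc (ht P n)            ≡⟨ UnitStrip.interior strip n 0<n ≤-refl ⟨
    ht Q n                  ≤⟨ m≤m+n (ht Q n) _ ⟩
    ht Q n + bit (last Q)   ≡⟨ ht-last Q ⟨
    ht Q (suc n)            ≡⟨ UnitStrip.end strip ⟩
    ht P (suc n)            ≡⟨ ht-last P ⟩
    ht P n + bit (last P)   ≡⟨ cong (λ b → ht P n + bit b) lastP ⟩
    ht P n + 0              ≡⟨ +-identityʳ (ht P n) ⟩
    ht P n                  ∎))
    where open ≤-Reasoning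

  unitStrip-length2 : ∀ {n} (n≡2 : n ≡ 2) (P Q : Vec Bool n) → UnitStrip P Q →
                      subst (Vec Bool) n≡2 P ≡ false ∷ true ∷ [] × subst (Vec Bool) n≡2 Q ≡ true ∷ false ∷ []
  unitStrip-length2 refl (x ∷ y ∷ []) (u ∷ v ∷ []) strip
    with unitStrip-head strip | unitStrip-last (x ∷ y ∷ []) (u ∷ v ∷ []) strip (s≤s z≤n)
  ... | refl | refl with u | v | UnitStrip.interior strip 1 (s≤s z≤n) ≤-refl | UnitStrip.end strip
  ... | true  | false | _  | _  = refl , refl
  ... | false | _     | () | _
  ... | true  | true  | _  | ()

module Evaluations where

  open import Defs
  open Snake
  open import Data.Nat as ℕ using (ℕ; zero; suc; _∸_)
  import Data.Nat.Properties as ℕ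
  open import Data.Integer using (ℤ; +_; -[1+_]; _+_; _*_; -_; _-_; _^_)
  open import Data.Integer.Properties
  open import Data.Integer.Tactic.RingSolver using (solve-∀)
  open import Data.Bool using (Bool; true; false; not; T)
  open import Data.Vec using (Vec; []; _∷_)
  open import Data.List using (List; []; _∷_; map; foldr; _++_)
  open import Data.List.Properties using (map-++; map-∘)
  open import Data.Fin.Subset using (Subset; ∣_∣; ⊤)
  open import Data.Product using (proj₁; proj₂)
  open import Data.Empty using (⊥-elim)
  open import Function using (_∘_)
  open import Relation.Binary.PropositionalEquality
  open import Relation.Nullary using (¬_; yes; no)

  Σ-subsets : ∀ n → (Subset n → ℤ) → ℤ
  Σ-subsets zero    f = f []
  Σ-subsets (suc n) f = Σ-subsets n (f ∘ (true ∷_)) + Σ-subsets n (f ∘ (false ∷_))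

  foldr-+-++ : ∀ (xs ys : List ℤ) → foldr _+_ (+ 0) (xs ++ ys) ≡ foldr _+_ (+ 0) xs + foldr _+_ (+ 0) ys
  foldr-+-++ []       ys = sym (+-identityˡ _)
  foldr-+-++ (x ∷ xs) ys = trans (cong (_+_ x) (foldr-+-++ xs ys)) (sym (+-assoc x _ _))

  foldr-allSubsets : ∀ n (f : Subset n → ℤ) → foldr _+_ (+ 0) (map f (allSubsets n)) ≡ Σ-subsets n f
  foldr-allSubsets zero    f = +-identityʳ (f [])
  foldr-allSubsets (suc n) f = begin
    Σ (map f (map (true ∷_) L ++ map (false ∷_) L))
      ≡⟨ cong Σ (map-++ f (map (true ∷_) L) _) ⟩
    Σ (map f (map (true ∷_) L) ++ map f (map (false ∷_) L))
      ≡⟨ foldr-+-++ (map f (map (true ∷_) L)) _ ⟩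
    Σ (map f (map (true ∷_) L)) + Σ (map f (map (false ∷_) L))
      ≡⟨ cong₂ _+_ (cong Σ (map-∘ L)) (cong Σ (map-∘ L)) ⟨
    Σ (map (f ∘ (true ∷_)) L) + Σ (map (f ∘ (false ∷_)) L)
      ≡⟨ cong₂ _+_ (foldr-allSubsets n _) (foldr-allSubsets n _) ⟩
    Σ-subsets (suc n) f
      ∎
    where
    open ≡-Reasoning
    L = allSubsets n
    Σ = foldr _+_ (+ 0)

  Σ-subsets-cong : ∀ n {f g : Subset n → ℤ} → (∀ A → f A ≡ g A) → Σ-subsets n f ≡ Σ-subsets n g
  Σ-subsets-cong zero    f≗g = f≗g []
  Σ-subsets-cong (suc n) f≗g =
    cong₂ _+_ (Σ-subsets-cong n (f≗g ∘ (true ∷_))) (Σ-subsets-cong n (f≗g ∘ (false ∷_)))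

  Σ-subsets-*ˡ : ∀ n c (f : Subset n → ℤ) → Σ-subsets n (λ A → c * f A) ≡ c * Σ-subsets n f
  Σ-subsets-*ˡ zero    c f = refl
  Σ-subsets-*ˡ (suc n) c f = trans (cong₂ _+_ (Σ-subsets-*ˡ n c _) (Σ-subsets-*ˡ n c _))
                                  (sym (*-distribˡ-+ c (Σ-subsets n (f ∘ (true ∷_))) _))

  Σ-subsets-neg : ∀ n (f : Subset n → ℤ) → Σ-subsets n (λ A → - f A) ≡ - Σ-subsets n f
  Σ-subsets-neg zero    f = refl
  Σ-subsets-neg (suc n) f = trans (cong₂ _+_ (Σ-subsets-neg n _) (Σ-subsets-neg n _))
                                 (sym (neg-distrib-+ (Σ-subsets n (f ∘ (true ∷_))) _))

  Σ-subsets-zero : ∀ n → Σ-subsets n (λ _ → + 0) ≡ + 0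
  Σ-subsets-zero zero    = refl
  Σ-subsets-zero (suc n) = cong₂ _+_ (Σ-subsets-zero n) (Σ-subsets-zero n)

  neg-*-neg : ∀ x y → - x * - y ≡ x * y
  neg-*-neg = solve-∀

  sign : ℕ → ℤ
  sign zero    = + 1
  sign (suc k) = - sign k

  -1^≡sign : ∀ k → -[1+ 0 ] ^ k ≡ sign k
  -1^≡sign zero    = refl
  -1^≡sign (suc k) = trans (-1*i≡-i _) (cong -_ (-1^≡sign k))

  sign-+ : ∀ a b → sign (a ℕ.+ b) ≡ sign a * sign b
  sign-+ zero    b = sym (*-identityˡ _)
  sign-+ (suc a) b = trans (cong -_ (sign-+ a b)) (neg-distribˡ-* (sign a) (sign b))

  sign*sign : ∀ a → sign a * sign a ≡ + 1
  sign*sign zero    = refl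
  sign*sign (suc a) = trans (neg-*-neg (sign a) (sign a)) (sign*sign a)

  sign-∸ : ∀ a b → b ℕ.≤ a → sign (a ∸ b) ≡ sign a * sign b
  sign-∸ a b b≤a = begin
    sign (a ∸ b)                    ≡⟨ *-identityʳ _ ⟨
    sign (a ∸ b) * + 1              ≡⟨ cong (sign (a ∸ b) *_) (sign*sign b) ⟨
    sign (a ∸ b) * (sign b * sign b) ≡⟨ *-assoc (sign (a ∸ b)) _ _ ⟨
    sign (a ∸ b) * sign b * sign b  ≡⟨ cong (_* sign b) (sign-+ (a ∸ b) b) ⟨
    sign (a ∸ b ℕ.+ b) * sign b     ≡⟨ cong (λ k → sign k * sign b) (ℕ.m∸n+n≡m b≤a) ⟩
    sign a * sign b                 ∎
    where open ≡-Reasoning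

  indicator : Bool → ℤ
  indicator true  = + 1
  indicator false = + 0

  τ₁₁ : ∀ {n} → Bool → Vec Bool n → ℤ
  τ₁₁ s     []           = indicator (not s)
  τ₁₁ false (false ∷ ps) = τ₁₁ true ps + τ₁₁ false ps
  τ₁₁ false (true ∷ ps)  = τ₁₁ false ps
  τ₁₁ true  (false ∷ ps) = τ₁₁ true ps
  τ₁₁ true  (true ∷ ps)  = τ₁₁ true ps + τ₁₁ false ps

  Σ-indicator≡τ₁₁ : ∀ {n} s (P : Vec Bool n) → Σ-subsets n (λ B → indicator (inStripᵇ s P B)) ≡ τ₁₁ s P
  Σ-indicator≡τ₁₁ false []           = refl
  Σ-indicator≡τ₁₁ true  []           = refl
  Σ-indicator≡τ₁₁ false (false ∷ ps) = cong₂ _+_ (Σ-indicator≡τ₁₁ true ps) (Σ-indicator≡τ₁₁ false ps)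
  Σ-indicator≡τ₁₁ {suc n} false (true ∷ ps) =
    trans (cong₂ _+_ (Σ-indicator≡τ₁₁ false ps) (Σ-subsets-zero n)) (+-identityʳ _)
  Σ-indicator≡τ₁₁ {suc n} true (false ∷ ps) =
    trans (cong₂ _+_ (Σ-subsets-zero n) (Σ-indicator≡τ₁₁ true ps)) (+-identityˡ _)
  Σ-indicator≡τ₁₁ true  (true ∷ ps)  = cong₂ _+_ (Σ-indicator≡τ₁₁ true ps) (Σ-indicator≡τ₁₁ false ps)

  τ₂₀ : ∀ {n} → Bool → Vec Bool n → ℤ
  τ₂₀ D     []           = + 1
  τ₂₀ D     (false ∷ ps) = - τ₂₀ true ps + τ₂₀ D ps
  τ₂₀ false (true ∷ ps)  = τ₂₀ false ps + τ₂₀ false ps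
  τ₂₀ true  (true ∷ ps)  = τ₂₀ true ps - τ₂₀ false ps

  Σ-sign≡τ₂₀ : ∀ {n} D (P : Vec Bool n) → Σ-subsets n (λ A → sign ∣ A ∣ * sign (stripRank D P A)) ≡ τ₂₀ D P
  Σ-sign≡τ₂₀ D [] = refl
  Σ-sign≡τ₂₀ {suc n} D (false ∷ ps) = cong₂ _+_
    (trans (Σ-subsets-cong n (λ A → sym (neg-distribˡ-* (sign ∣ A ∣) _)))
           (trans (Σ-subsets-neg n _) (cong -_ (Σ-sign≡τ₂₀ true ps))))
    (Σ-sign≡τ₂₀ D ps)
  Σ-sign≡τ₂₀ {suc n} false (true ∷ ps) = cong₂ _+_
    (trans (Σ-subsets-cong n (λ A → neg-*-neg (sign ∣ A ∣) _)) (Σ-sign≡τ₂₀ false ps))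
    (Σ-sign≡τ₂₀ false ps)
  Σ-sign≡τ₂₀ {suc n} true (true ∷ ps) = cong₂ _+_
    (trans (Σ-subsets-cong n (λ A → neg-*-neg (sign ∣ A ∣) _)) (Σ-sign≡τ₂₀ true ps))
    (trans (Σ-subsets-cong n (λ A → sym (neg-distribʳ-* (sign ∣ A ∣) _)))
           (trans (Σ-subsets-neg n _) (cong -_ (Σ-sign≡τ₂₀ false ps))))

  τ₀₂ : ∀ {n} → Bool → Vec Bool n → ℤ
  τ₀₂ D     []           = + 1
  τ₀₂ D     (false ∷ ps) = τ₀₂ true ps + τ₀₂ D ps
  τ₀₂ false (true ∷ ps)  = - τ₀₂ false ps + τ₀₂ false ps
  τ₀₂ true  (true ∷ ps)  = - τ₀₂ true ps - τ₀₂ false ps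

  Σ-sign≡τ₀₂ : ∀ {n} D (P : Vec Bool n) → Σ-subsets n (λ A → sign (stripRank D P A)) ≡ τ₀₂ D P
  Σ-sign≡τ₀₂ D [] = refl
  Σ-sign≡τ₀₂ D (false ∷ ps) = cong₂ _+_ (Σ-sign≡τ₀₂ true ps) (Σ-sign≡τ₀₂ D ps)
  Σ-sign≡τ₀₂ {suc n} false (true ∷ ps) = cong₂ _+_
    (trans (Σ-subsets-neg n _) (cong -_ (Σ-sign≡τ₀₂ false ps))) (Σ-sign≡τ₀₂ false ps)
  Σ-sign≡τ₀₂ {suc n} true (true ∷ ps) = cong₂ _+_
    (trans (Σ-subsets-neg n _) (cong -_ (Σ-sign≡τ₀₂ true ps)))
    (trans (Σ-subsets-neg n _) (cong -_ (Σ-sign≡τ₀₂ false ps)))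

  indicator-true : ∀ {b} → T b → indicator b ≡ + 1
  indicator-true {true} _ = refl

  indicator-false : ∀ {b} → ¬ T b → indicator b ≡ + 0
  indicator-false {true}  ¬b = ⊥-elim (¬b _)
  indicator-false {false} _  = refl

  0^-positive : ∀ k → 0 ℕ.< k → (+ 0) ^ k ≡ + 0
  0^-positive (suc k) _ = refl

  module _ {m r} (P Q : Vec Bool (m ℕ.+ r)) (strip : UnitStrip P Q) (isPath : IsPath m r P) where

    private
      n = m ℕ.+ r
      ρ = stripRank false P

    tutte≡Σ-subsets : ∀ x y →
      tutte m r P Q x y ≡ Σ-subsets n (λ A → (x - + 1) ^ (∣ P ∣ ∸ ρ A) * (y - + 1) ^ (∣ A ∣ ∸ ρ A))
    tutte≡Σ-subsets x y = trans (foldr-allSubsets n _) (Σ-subsets-cong n λ A →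
      cong₂ (λ rE rA → (x - + 1) ^ (rE ∸ rA) * (y - + 1) ^ (∣ A ∣ ∸ rA))
            (trans (rank≡stripRank P Q strip isPath ⊤) (stripRank-⊤ false P))
            (rank≡stripRank P Q strip isPath A))

    tutte₁₁≡τ₁₁ : tutte m r P Q (+ 1) (+ 1) ≡ τ₁₁ false P
    tutte₁₁≡τ₁₁ = trans (tutte≡Σ-subsets (+ 1) (+ 1)) (trans (Σ-subsets-cong n term) (Σ-indicator≡τ₁₁ false P))
      where
      term : ∀ A → (+ 0) ^ (∣ P ∣ ∸ ρ A) * (+ 0) ^ (∣ A ∣ ∸ ρ A) ≡ indicator (inStripᵇ false P A)
      term A with ∣ P ∣ ℕ.≤? ρ A | ∣ A ∣ ℕ.≤? ρ A
      ... | yes spanning | yes independent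
        rewrite ℕ.m≤n⇒m∸n≡0 spanning | ℕ.m≤n⇒m∸n≡0 independent =
          sym (indicator-true (full⇒inStripᵇ P A spanning independent))
      ... | no ¬spanning | _
        rewrite 0^-positive (∣ P ∣ ∸ ρ A) (ℕ.m<n⇒0<n∸m (ℕ.≰⇒> ¬spanning)) =
          sym (indicator-false (¬spanning ∘ proj₁ ∘ inStripᵇ⇒full P A))
      ... | yes _ | no ¬independent
        rewrite 0^-positive (∣ A ∣ ∸ ρ A) (ℕ.m<n⇒0<n∸m (ℕ.≰⇒> ¬independent)) =
          trans (*-zeroʳ ((+ 0) ^ (∣ P ∣ ∸ ρ A)))
                (sym (indicator-false (¬independent ∘ proj₂ ∘ inStripᵇ⇒full P A)))

    tutte₂₀≡τ₂₀ : tutte m r P Q (+ 2) (+ 0) ≡ τ₂₀ false P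
    tutte₂₀≡τ₂₀ = trans (tutte≡Σ-subsets (+ 2) (+ 0)) (trans (Σ-subsets-cong n term) (Σ-sign≡τ₂₀ false P))
      where
      term : ∀ A → (+ 1) ^ (∣ P ∣ ∸ ρ A) * -[1+ 0 ] ^ (∣ A ∣ ∸ ρ A) ≡ sign ∣ A ∣ * sign (ρ A)
      term A rewrite ^-zeroˡ (∣ P ∣ ∸ ρ A) =
        trans (*-identityˡ _) (trans (-1^≡sign (∣ A ∣ ∸ ρ A)) (sign-∸ ∣ A ∣ (ρ A) (stripRank≤∣∣ P A)))

    tutte₀₂≡τ₀₂ : tutte m r P Q (+ 0) (+ 2) ≡ sign ∣ P ∣ * τ₀₂ false P
    tutte₀₂≡τ₀₂ = trans (tutte≡Σ-subsets (+ 0) (+ 2)) (trans (Σ-subsets-cong n term)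
      (trans (Σ-subsets-*ˡ n (sign ∣ P ∣) _) (cong (sign ∣ P ∣ *_) (Σ-sign≡τ₀₂ false P))))
      where
      term : ∀ A → -[1+ 0 ] ^ (∣ P ∣ ∸ ρ A) * (+ 1) ^ (∣ A ∣ ∸ ρ A) ≡ sign ∣ P ∣ * sign (ρ A)
      term A rewrite ^-zeroˡ (∣ A ∣ ∸ ρ A) =
        trans (*-identityʳ _) (trans (-1^≡sign (∣ P ∣ ∸ ρ A)) (sign-∸ ∣ P ∣ (ρ A) (stripRank≤∣P∣ P A)))

module Inequality where

  open import Data.Nat
  open import Data.Nat.Properties
  open import Data.Nat.Tactic.RingSolver using (solve)
  open import Data.List using (_∷_; [])
  open import Data.Unit using (tt)

  record Invariant (p q X Y : ℕ) : Set where
    constructor invariant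
    field
      q≤p    : q ≤ p
      bound₁ : 4 * (p * q) ≤ Y
      bound₂ : 2 * (p * (p + q)) ≤ X + Y
      bound₃ : 4 * ((p + q) * (p + q)) ≤ 3 * (X + Y)

  private
    module Steps {p q X Y : ℕ} (q≤p : q ≤ p) (bound₁ : 4 * (p * q) ≤ Y)
                 (bound₂ : 2 * (p * (p + q)) ≤ X + Y) (bound₃ : 4 * ((p + q) * (p + q)) ≤ 3 * (X + Y)) where
      open ≤-Reasoning

      q*q≤p*q : q * q ≤ p * q
      q*q≤p*q = *-monoˡ-≤ q q≤p

      extend : Invariant (p + q) q (X + Y) (2 * Y)
      extend = invariant (m≤n+m q p)
        (begin
          4 * ((p + q) * q)             ≡⟨ solve (p ∷ q ∷ []) ⟩
          4 * (p * q) + 4 * (q * q)     ≤⟨ +-monoʳ-≤ (4 * (p * q)) (*-monoʳ-≤ 4 q*q≤p*q) ⟩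
          4 * (p * q) + 4 * (p * q)     ≤⟨ +-mono-≤ bound₁ bound₁ ⟩
          Y + Y                         ≡⟨ solve (Y ∷ []) ⟩
          2 * Y                         ∎)
        (begin
          2 * ((p + q) * (p + q + q))                    ≡⟨ solve (p ∷ q ∷ []) ⟩
          2 * (p * (p + q)) + 4 * (p * q) + 4 * (q * q)  ≤⟨ +-monoʳ-≤ (2 * (p * (p + q)) + 4 * (p * q))
                                                                        (*-monoʳ-≤ 4 q*q≤p*q) ⟩
          2 * (p * (p + q)) + 4 * (p * q) + 4 * (p * q)  ≤⟨ +-mono-≤ (+-mono-≤ bound₂ bound₁) bound₁ ⟩
          X + Y + Y + Y                                  ≡⟨ solve (X ∷ Y ∷ []) ⟩
          X + Y + 2 * Y                                  ∎)
        (begin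
          4 * ((p + q + q) * (p + q + q))                       ≡⟨ solve (p ∷ q ∷ []) ⟩
          4 * ((p + q) * (p + q)) + 8 * (p * q) + 12 * (q * q)  ≤⟨ +-monoʳ-≤ (4 * ((p + q) * (p + q)) + 8 * (p * q))
                                                                               (*-monoʳ-≤ 12 q*q≤p*q) ⟩
          4 * ((p + q) * (p + q)) + 8 * (p * q) + 12 * (p * q)  ≡⟨ solve (p ∷ q ∷ []) ⟩
          4 * ((p + q) * (p + q)) + 5 * (4 * (p * q))           ≤⟨ +-mono-≤ bound₃ (*-monoʳ-≤ 5 bound₁) ⟩
          3 * (X + Y) + 5 * Y                                   ≤⟨ +-monoʳ-≤ (3 * (X + Y)) (*-monoˡ-≤ Y (≤ᵇ⇒≤ 5 6 tt)) ⟩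
          3 * (X + Y) + 6 * Y                                   ≡⟨ solve (X ∷ Y ∷ []) ⟩
          3 * (X + Y + 2 * Y)                                   ∎)

      turn : Invariant (p + q) p (X + Y) (2 * (X + Y))
      turn = invariant (m≤m+n p q)
        (begin
          4 * ((p + q) * p)        ≡⟨ solve (p ∷ q ∷ []) ⟩
          2 * (2 * (p * (p + q)))  ≤⟨ *-monoʳ-≤ 2 bound₂ ⟩
          2 * (X + Y)              ∎)
        (begin
          2 * ((p + q) * (p + q + p))                                ≤⟨ m≤m+n _ (2 * (p * q) + 2 * (q * q)) ⟩
          2 * ((p + q) * (p + q + p)) + (2 * (p * q) + 2 * (q * q))  ≡⟨ solve (p ∷ q ∷ []) ⟩
          4 * ((p + q) * (p + q))                                    ≤⟨ bound₃ ⟩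
          3 * (X + Y)                                                ≡⟨ solve (X ∷ Y ∷ []) ⟩
          X + Y + 2 * (X + Y)                                        ∎)
        (begin
          4 * ((p + q + p) * (p + q + p))                            ≡⟨ solve (p ∷ q ∷ []) ⟩
          16 * (p * p) + 16 * (p * q) + 2 * (q * q) + 2 * (q * q)
            ≤⟨ +-mono-≤ (+-monoʳ-≤ (16 * (p * p) + 16 * (p * q)) (*-monoʳ-≤ 2 (≤-trans q*q≤p*q (*-monoʳ-≤ p q≤p))))
                        (*-monoʳ-≤ 2 q*q≤p*q) ⟩
          16 * (p * p) + 16 * (p * q) + 2 * (p * p) + 2 * (p * q)    ≡⟨ solve (p ∷ q ∷ []) ⟩
          9 * (2 * (p * (p + q)))                                    ≤⟨ *-monoʳ-≤ 9 bound₂ ⟩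
          9 * (X + Y)                                                ≡⟨ solve (X ∷ Y ∷ []) ⟩
          3 * (X + Y + 2 * (X + Y))                                  ∎)

  Invariant-extend : ∀ {p q X Y} → Invariant p q X Y → Invariant (p + q) q (X + Y) (2 * Y)
  Invariant-extend (invariant q≤p bound₁ bound₂ bound₃) = Steps.extend q≤p bound₁ bound₂ bound₃

  Invariant-turn : ∀ {p q X Y} → Invariant p q X Y → Invariant (p + q) p (X + Y) (2 * (X + Y))
  Invariant-turn (invariant q≤p bound₁ bound₂ bound₃) = Steps.turn q≤p bound₁ bound₂ bound₃

module PathRecurrence where

  open import Data.Nat
  open import Data.Nat.Properties using (+-comm; ≤ᵇ⇒≤)
  open import Data.Nat.Tactic.RingSolver using (solve-∀)
  open import Data.Bool using (Bool; true; false)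
  open import Data.Vec using (Vec; []; _∷_; head)
  open import Data.Product using (_×_; _,_)
  open import Data.Unit using (tt)
  open import Relation.Binary.PropositionalEquality using (_≡_; refl; subst; subst₂)
  open Snake using (last)
  open Inequality

  -- (n₀, n₁), (a, -b) and (c, d) are the values of τ₁₁, τ₂₀ and sign ∣ v ∣ * τ₀₂ at the states
  -- false and true (see Represents).
  record Counts : Set where
    constructor counts
    field n₀ n₁ a b c d : ℕ

  step : Bool → Counts → Counts
  step false (counts n₀ n₁ a b c d) = counts (n₀ + n₁) n₁ (a + b) 0 (c + d) (d + d)
  step true  (counts n₀ n₁ a b c d) = counts n₀ (n₀ + n₁) (a + a) (a + b) 0 (c + d)

  -- The base case is the one-step path N, which ends every unit strip; its first entry is ignored.
  countsOf : ∀ {k} → Vec Bool (suc k) → Counts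
  countsOf (_ ∷ [])     = counts 1 1 2 0 0 2
  countsOf (x ∷ y ∷ ys) = step x (countsOf (y ∷ ys))

  -- For the counts of v with first step h, p + q = T(1,1) and X + Y = T(2,0) T(0,2) of the path E v.
  Good : Bool → Counts → Set
  Good false (counts n₀ n₁ a b c d) = b ≡ 0 × Invariant n₀ n₁ (a * c) (a * d)
  Good true  (counts n₀ n₁ a b c d) = c ≡ 0 × Invariant n₁ n₀ (b * d) (a * d)

  Invariant-resp : ∀ {p p′ q X X′ Y Y′} → p ≡ p′ → X ≡ X′ → Y ≡ Y′ → Invariant p q X Y → Invariant p′ q X′ Y′
  Invariant-resp refl refl refl inv = inv

  step-Good : ∀ x y s → Good y s → Good x (step x s)
  step-Good false false (counts n₀ n₁ a .0 c d) (refl , inv) =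
    refl , Invariant-resp refl (e₁ a c d) (e₂ a d) (Invariant-extend inv)
    where
    e₁ : ∀ a c d → a * c + a * d ≡ (a + 0) * (c + d)
    e₁ = solve-∀
    e₂ : ∀ a d → 2 * (a * d) ≡ (a + 0) * (d + d)
    e₂ = solve-∀
  step-Good true false (counts n₀ n₁ a .0 c d) (refl , inv) =
    refl , Invariant-resp refl (e₁ a c d) (e₂ a c d) (Invariant-turn inv)
    where
    e₁ : ∀ a c d → a * c + a * d ≡ (a + 0) * (c + d)
    e₁ = solve-∀
    e₂ : ∀ a c d → 2 * (a * c + a * d) ≡ (a + a) * (c + d)
    e₂ = solve-∀
  step-Good true true (counts n₀ n₁ a b .0 d) (refl , inv) =
    refl , Invariant-resp (+-comm n₁ n₀) (e₁ a b d) (e₂ a d) (Invariant-extend inv)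
    where
    e₁ : ∀ a b d → b * d + a * d ≡ (a + b) * (0 + d)
    e₁ = solve-∀
    e₂ : ∀ a d → 2 * (a * d) ≡ (a + a) * (0 + d)
    e₂ = solve-∀
  step-Good false true (counts n₀ n₁ a b .0 d) (refl , inv) =
    refl , Invariant-resp (+-comm n₁ n₀) (e₁ a b d) (e₂ a b d) (Invariant-turn inv)
    where
    e₁ : ∀ a b d → b * d + a * d ≡ (a + b) * (0 + d)
    e₁ = solve-∀
    e₂ : ∀ a b d → 2 * (b * d + a * d) ≡ (a + b) * (d + d)
    e₂ = solve-∀

  invariant-base : Invariant 2 1 4 8
  invariant-base = invariant (≤ᵇ⇒≤ 1 2 tt) (≤ᵇ⇒≤ 8 8 tt) (≤ᵇ⇒≤ 12 12 tt) (≤ᵇ⇒≤ 36 36 tt)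

  countsOf-Good : ∀ {k} (v : Vec Bool (suc (suc k))) → last v ≡ true → Good (head v) (countsOf v)
  countsOf-Good (false ∷ true ∷ [])  refl     = refl , invariant-base
  countsOf-Good (true ∷ true ∷ [])   refl     = refl , invariant-base
  countsOf-Good (x ∷ y ∷ z ∷ zs)     lastTrue = step-Good x y _ (countsOf-Good (y ∷ z ∷ zs) lastTrue)

  Good⇒bound : ∀ h s → Good h s →
               let open Counts s in 4 * ((n₀ + n₁) * (n₀ + n₁)) ≤ 3 * ((a + b) * (c + d))
  Good⇒bound false (counts n₀ n₁ a .0 c d) (refl , inv) =
    subst (λ z → 4 * ((n₀ + n₁) * (n₀ + n₁)) ≤ 3 * z) (e a c d) (Invariant.bound₃ inv)
    where
    e : ∀ a c d → a * c + a * d ≡ (a + 0) * (c + d)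
    e = solve-∀
  Good⇒bound true (counts n₀ n₁ a b .0 d) (refl , inv) =
    subst₂ (λ z w → 4 * (z * z) ≤ 3 * w) (+-comm n₁ n₀) (e a b d) (Invariant.bound₃ inv)
    where
    e : ∀ a b d → b * d + a * d ≡ (a + b) * (0 + d)
    e = solve-∀

open import Defs
open import Data.Nat using (ℕ; suc; z≤n; s≤s)
import Data.Nat as ℕ
import Data.Nat.Properties as ℕ
open import Data.Integer using (+_; -_; _+_; _-_; _*_; _≤_; +≤+)
open import Data.Integer.Properties
  using (pos-+; pos-*; +-comm; +-inverseˡ; *-zeroʳ; *-distribˡ-+; module ≤-Reasoning)
open import Data.Integer.Tactic.RingSolver using (solve-∀)
open import Data.Bool using (Bool; true; false)
open import Data.Vec using (Vec; []; _∷_; head)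
open import Data.Fin.Subset using (∣_∣)
open import Data.Product using (_,_)
open import Data.Empty using (⊥-elim)
open import Function using (_∘_)
open import Relation.Binary.PropositionalEquality
open import Relation.Nullary using (¬_; yes; no)
open Snake
open Evaluations
open PathRecurrence

record Represents {k} (s : Counts) (v : Vec Bool k) : Set where
  field
    τ₁₁-false : τ₁₁ false v ≡ + Counts.n₀ s
    τ₁₁-true  : τ₁₁ true v ≡ + Counts.n₁ s
    τ₂₀-false : τ₂₀ false v ≡ + Counts.a s
    τ₂₀-true  : τ₂₀ true v ≡ - + Counts.b s
    τ₀₂-false : sign ∣ v ∣ * τ₀₂ false v ≡ + Counts.c s
    τ₀₂-true  : sign ∣ v ∣ * τ₀₂ true v ≡ + Counts.d s

+n++m≡+[m+n] : ∀ m n → + n + + m ≡ + (m ℕ.+ n)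
+n++m≡+[m+n] m n = trans (+-comm (+ n) (+ m)) (sym (pos-+ m n))

step-Represents : ∀ x {k} (w : Vec Bool k) s → Represents s w → Represents (step x s) (x ∷ w)
step-Represents false w (counts n₀ n₁ a b c d) rep = record
  { τ₁₁-false = trans (cong₂ _+_ τ₁₁-true τ₁₁-false) (+n++m≡+[m+n] n₀ n₁)
  ; τ₁₁-true  = τ₁₁-true
  ; τ₂₀-false = trans (cong₂ (λ u v → - u + v) τ₂₀-true τ₂₀-false) (trans (neg-neg-+ (+ a) (+ b)) (sym (pos-+ a b)))
  ; τ₂₀-true  = +-inverseˡ (τ₂₀ true w)
  ; τ₀₂-false = trans (*-distribˡ-+ (sign ∣ w ∣) (τ₀₂ true w) _)
                      (trans (cong₂ _+_ τ₀₂-true τ₀₂-false) (+n++m≡+[m+n] c d))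
  ; τ₀₂-true  = trans (*-distribˡ-+ (sign ∣ w ∣) (τ₀₂ true w) _)
                      (trans (cong₂ _+_ τ₀₂-true τ₀₂-true) (sym (pos-+ d d)))
  }
  where
  open Represents rep
  neg-neg-+ : ∀ x y → - - y + x ≡ x + y
  neg-neg-+ = solve-∀
step-Represents true w (counts n₀ n₁ a b c d) rep = record
  { τ₁₁-false = τ₁₁-false
  ; τ₁₁-true  = trans (cong₂ _+_ τ₁₁-true τ₁₁-false) (+n++m≡+[m+n] n₀ n₁)
  ; τ₂₀-false = trans (cong₂ _+_ τ₂₀-false τ₂₀-false) (sym (pos-+ a a))
  ; τ₂₀-true  = trans (cong₂ _-_ τ₂₀-true τ₂₀-false) (trans (neg-sub (+ a) (+ b)) (cong -_ (sym (pos-+ a b))))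
  ; τ₀₂-false = trans (cong (- sign ∣ w ∣ *_) (+-inverseˡ (τ₀₂ false w))) (*-zeroʳ (- sign ∣ w ∣))
  ; τ₀₂-true  = trans (neg-*-neg-sub (sign ∣ w ∣) (τ₀₂ true w) (τ₀₂ false w))
                      (trans (cong₂ _+_ τ₀₂-true τ₀₂-false) (+n++m≡+[m+n] c d))
  }
  where
  open Represents rep
  neg-sub : ∀ x y → - y - x ≡ - (x + y)
  neg-sub = solve-∀
  neg-*-neg-sub : ∀ σ x y → - σ * (- x - y) ≡ σ * x + σ * y
  neg-*-neg-sub = solve-∀

countsOf-Represents : ∀ {k} (v : Vec Bool (suc k)) → last v ≡ true → Represents (countsOf v) v
countsOf-Represents (true ∷ [])   refl     = record
  { τ₁₁-false = refl ; τ₁₁-true = refl ; τ₂₀-false = refl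
  ; τ₂₀-true  = refl ; τ₀₂-false = refl ; τ₀₂-true = refl }
countsOf-Represents (x ∷ y ∷ ys) lastTrue =
  step-Represents x (y ∷ ys) (countsOf (y ∷ ys)) (countsOf-Represents (y ∷ ys) lastTrue)

unitStrip-inequality : ∀ {n} (P Q : Vec Bool n) → UnitStrip P Q → 3 ℕ.≤ n →
  + 4 * (τ₁₁ false P * τ₁₁ false P) ≤ + 3 * (τ₂₀ false P * (sign ∣ P ∣ * τ₀₂ false P))
unitStrip-inequality (p ∷ w@(_ ∷ _ ∷ _)) Q strip (s≤s (s≤s (s≤s z≤n)))
  with refl ← unitStrip-head strip =
  begin
    + 4 * (τ₁₁ false P * τ₁₁ false P)                    ≡⟨ cong (λ t → + 4 * (t * t)) τ₁₁-false ⟩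
    + 4 * (+ N * + N)                                    ≡⟨ cong (+ 4 *_) (sym (pos-* N N)) ⟩
    + 4 * + (N ℕ.* N)                                    ≡⟨ sym (pos-* 4 (N ℕ.* N)) ⟩
    + (4 ℕ.* (N ℕ.* N))                                  ≤⟨ +≤+ (Good⇒bound (head w) s (countsOf-Good w lastTrue)) ⟩
    + (3 ℕ.* (A ℕ.* C))                                  ≡⟨ pos-* 3 (A ℕ.* C) ⟩
    + 3 * + (A ℕ.* C)                                    ≡⟨ cong (+ 3 *_) (pos-* A C) ⟩
    + 3 * (+ A * + C)                                    ≡⟨ cong₂ (λ x y → + 3 * (x * y)) τ₂₀-false τ₀₂-false ⟨
    + 3 * (τ₂₀ false P * (sign ∣ P ∣ * τ₀₂ false P))     ∎
  where
  open ≤-Reasoning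
  P = false ∷ w
  lastTrue = unitStrip-last P Q strip (s≤s z≤n)
  s = countsOf w
  open Counts s
  N = n₀ ℕ.+ n₁
  A = a ℕ.+ b
  C = c ℕ.+ d
  open Represents (step-Represents false w s (countsOf-Represents w lastTrue))

proposition4p1 : (m r : ℕ) (P Q : Vec Bool (m Data.Nat.+ r)) →
    IsPath m r P → IsPath m r Q → NeverAbove P Q →
    IsSnake m r P Q → ¬ IsTrivial m r P Q →
    (+ 4) * (tutte m r P Q (+ 1) (+ 1) * tutte m r P Q (+ 1) (+ 1))
    ≤ (+ 3) * (tutte m r P Q (+ 2) (+ 0) * tutte m r P Q (+ 0) (+ 2))
proposition4p1 m r P Q isPathP isPathQ P≤Q snake@(2≤n , _) nontrivial = begin
  + 4 * (tutte m r P Q (+ 1) (+ 1) * tutte m r P Q (+ 1) (+ 1))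
    ≡⟨ cong (λ t → + 4 * (t * t)) (tutte₁₁≡τ₁₁ P Q strip isPathP) ⟩
  + 4 * (τ₁₁ false P * τ₁₁ false P)
    ≤⟨ unitStrip-inequality P Q strip 3≤n ⟩
  + 3 * (τ₂₀ false P * (sign ∣ P ∣ * τ₀₂ false P))
    ≡⟨ cong₂ (λ x y → + 3 * (x * y)) (tutte₂₀≡τ₂₀ P Q strip isPathP) (tutte₀₂≡τ₀₂ P Q strip isPathP) ⟨
  + 3 * (tutte m r P Q (+ 2) (+ 0) * tutte m r P Q (+ 0) (+ 2))  ∎
  where
  open ≤-Reasoning
  strip = snake⇒UnitStrip P Q isPathP isPathQ P≤Q snake
  3≤n : 3 ℕ.≤ m ℕ.+ r
  3≤n with m ℕ.+ r ℕ.≟ 2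
  ... | yes n≡2 = ⊥-elim (nontrivial (n≡2 , unitStrip-length2 n≡2 P Q strip))
  ... | no  n≢2 = ℕ.≤∧≢⇒< 2≤n (n≢2 ∘ sym)
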